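{- Let $cl$ be a loopless closure operator on a finite set $I$ such that $L_{cl}$ is supersolvable. If $\mathfrak c$ is a chief chain in $L_{cl}$, then for each maximal chain $m$ in $L_{cl}$, $V_{pr(\mathfrak c,m)}\cap\mathrm{supp}(\mathfrak c)\subseteq V_{cl}$.
   Context: A closure operator on $I$ is $cl:2^I\to2^I$ with $A\subseteq cl(A)$, $cl(cl(A))=cl(A)$, $A\subseteq B\Rightarrow cl(A)\subseteq cl(B)$; loopless means $cl(\emptyset)=\emptyset$. Closed sets: $cl(A)=A$. $L_{cl}$ is the lattice of closed sets under inclusion. A chief chain of a lattice $L$ is a maximal chain $\mathfrak c$ such that for every chain $m$ of $L$ the smallest sublattice of $L$ containing $\mathfrak c$ and $m$ is distributive; $L$ is supersolvable if it has a chief chain. A chain $\emptyset=A_0\subsetneq A_1\subsetneq\dots\subsetneq A_k=I$ of subsets is identified with the set composition $(c_1,\dots,c_k)$, $c_i=A_i\setminus A_{i-1}$ (a face of the braid arrangement of $I$). A preorder on $I$ is a reflexive transitive relation; its lower sets are the $S$ with $s\in S$, $a\preceq s\Rightarrow a\in S$. For chains $c,c'$ of subsets, $pr(c,c')$ is the smallest preorder whose family of lower sets contains all members of $c$ and $c'$, and for a preorder $pr$, $V_{pr}$ is the set of set compositions of $I$ all of whose initial unions are lower sets of $pr$. For $\mathfrak c=(\mathfrak c_1,\dots,\mathfrak c_k)$, $\mathrm{supp}(\mathfrak c)$ (the support flat) is the set of set compositions of $I$ each of whose blocks is a union of some of the $\mathfrak c_i$. $V_{cl}$ is the set of set compositions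 of $I$ all of whose initial unions are closed. -}

module Defs where

open import Data.Nat using (ℕ)
open import Data.Fin using (Fin)
open import Data.Fin.Subset using (Subset; _⊆_; _⊂_; _∈_; _∩_; _∪_; _─_; ⋃; ⊥; ⊤; Nonempty)
open import Data.List using (List; []; _∷_; _++_; map; inits)
open import Data.List.Membership.Propositional using () renaming (_∈_ to _∈ₗ_)
open import Data.List.Relation.Unary.All using (All)
open import Data.List.Relation.Unary.AllPairs using (AllPairs)
open import Data.List.Relation.Unary.Linked using (Linked)
open import Data.Product using (_×_; Σ; ∃)
open import Data.Sum using (_⊎_)
open import Relation.Binary.PropositionalEquality using (_≡_)

-- The finite ground set I is Fin n; subsets of I are Data.Fin.Subset.

record ClosureOperator (n : ℕ) : Set where
  field
    cl         : Subset n → Subset n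
    extensive  : ∀ A → A ⊆ cl A
    idempotent : ∀ A → cl (cl A) ≡ cl A
    monotone   : ∀ A B → A ⊆ B → cl A ⊆ cl B

module _ {n : ℕ} (C : ClosureOperator n) where
  open ClosureOperator C

  Loopless : Set
  Loopless = cl ⊥ ≡ ⊥

  Closed : Subset n → Set
  Closed A = cl A ≡ A

  -- Lattice operations of L_cl (the lattice of closed sets under inclusion):
  -- meet of closed sets is their intersection, join is the closure of the union.
  _∧L_ : Subset n → Subset n → Subset n
  A ∧L B = A ∩ B

  _∨L_ : Subset n → Subset n → Subset n
  A ∨L B = cl (A ∪ B)

  -- A chain of L_cl, listed by strictly increasing inclusion
  -- (every finite chain has exactly one such listing).
  IsChain : List (Subset n) → Set
  IsChain xs = All Closed xs × Linked _⊂_ xs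

  Comparable : Subset n → Subset n → Set
  Comparable X Y = X ⊆ Y ⊎ Y ⊆ X

  IsMaximalChain : List (Subset n) → Set
  IsMaximalChain xs =
    IsChain xs × (∀ X → Closed X → All (Comparable X) xs → X ∈ₗ xs)

  data InSublattice (S : List (Subset n)) : Subset n → Set where
    base : ∀ {X} → X ∈ₗ S → InSublattice S X
    meet : ∀ {X Y} → InSublattice S X → InSublattice S Y → InSublattice S (X ∧L Y)
    join : ∀ {X Y} → InSublattice S X → InSublattice S Y → InSublattice S (X ∨L Y)

  DistributiveSublattice : List (Subset n) → Set
  DistributiveSublattice S =
    ∀ X Y Z → InSublattice S X → InSublattice S Y → InSublattice S Z →
    X ∧L (Y ∨L Z) ≡ (X ∧L Y) ∨L (X ∧L Z)

  IsChiefChain : List (Subset n) → Set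
  IsChiefChain c =
    IsMaximalChain c × (∀ m → IsChain m → DistributiveSublattice (c ++ m))

  Supersolvable : Set
  Supersolvable = ∃ IsChiefChain

Disjoint : {n : ℕ} → Subset n → Subset n → Set
Disjoint A B = A ∩ B ≡ ⊥

IsSetComposition : {n : ℕ} → List (Subset n) → Set
IsSetComposition F = All Nonempty F × AllPairs Disjoint F × ⋃ F ≡ ⊤

initialUnions : {n : ℕ} → List (Subset n) → List (Subset n)
initialUnions F = map ⋃ (inits F)

V : {n : ℕ} → (Subset n → Set) → List (Subset n) → Set
V P F = IsSetComposition F × All P (initialUnions F)

Vcl : {n : ℕ} → ClosureOperator n → List (Subset n) → Set
Vcl C = V (Closed C)

IsLowerSet : {n : ℕ} → (Fin n → Fin n → Set) → Subset n → Set
IsLowerSet _≼_ S = ∀ a s → s ∈ S → a ≼ s → a ∈ S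

-- pr(c, c'): the preorder a ≼ b iff every member of c or c' containing b
-- contains a; this is the preorder with the smallest family of lower sets
-- containing all members of c and c'.
pr : {n : ℕ} → List (Subset n) → List (Subset n) → Fin n → Fin n → Set
pr c c' a b = ∀ S → S ∈ₗ (c ++ c') → b ∈ S → a ∈ S

Vpr : {n : ℕ} → (Fin n → Fin n → Set) → List (Subset n) → Set
Vpr R = V (IsLowerSet R)

chainBlocks : {n : ℕ} → List (Subset n) → List (Subset n)
chainBlocks (A ∷ B ∷ rest) = (B ─ A) ∷ chainBlocks (B ∷ rest)
chainBlocks _ = []

InSupp : {n : ℕ} → List (Subset n) → List (Subset n) → Set
InSupp c F =
  IsSetComposition F ×
  All (λ B → Σ (List (Subset _)) λ sel → All (_∈ₗ chainBlocks c) sel × B ≡ ⋃ sel) F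

-- Every initial union U of F is a lower set of pr(𝔠, m) and a union of blocks of 𝔠; we show that
-- such a U is closed. For s ∈ U let ↓s be the intersection of the members of 𝔠 and m containing s;
-- it lies in the sublattice generated by 𝔠 and m, and ↓s ⊆ U because U is a lower set. Hence
-- cl U is the join of the ↓s, s ∈ U. If x ∈ cl U ∖ U, choose adjacent P ⊂ Q in 𝔠 with x ∈ Q ∖ P.
-- The block Q ∖ P is not inside U, so Q ∩ ↓s ⊆ P for every s ∈ U, and distributivity of the
-- sublattice generated by 𝔠 and m gives Q ∩ cl U = ⋁ (Q ∩ ↓s) ⊆ P, contradicting x ∈ Q ∖ P.
module Submission where

open import Defs
open import Data.Nat using (ℕ)
open import Data.Fin using (Fin)
open import Data.Vec.Base using (_∷_; here; there)
open import Data.Fin.Subset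
open import Data.Fin.Subset.Properties
open import Data.List using (List; []; _∷_; _++_; allFin; map; filter)
open import Data.List.Membership.Propositional using (lose; find) renaming (_∈_ to _∈ₗ_)
open import Data.List.Membership.Propositional.Properties
  using (∈-++⁺ˡ; ∈-allFin; ∈-map⁺; ∈-filter⁺)
open import Data.List.Relation.Unary.Any using (Any; here; there)
open import Data.List.Relation.Unary.All as All using (All; []; _∷_)
open import Data.List.Relation.Unary.All.Properties using (inits⁺; map⁺; all-filter; filter⁺)
open import Data.List.Relation.Unary.AllPairs using (AllPairs; []; _∷_)
open import Data.List.Relation.Unary.Linked as Linked using ()
open import Data.List.Relation.Unary.Linked.Properties using (Linked⇒AllPairs)
open import Data.Product using (_×_; _,_; proj₁; proj₂; ∃₂; Σ; uncurry)
open import Data.Sum using (_⊎_; inj₁; inj₂)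
open import Relation.Nullary using (yes; no; contradiction)
open import Relation.Binary.PropositionalEquality using (_≡_; refl; subst)

x∈p─q⇒x∉q : ∀ {n} (p q : Subset n) {x} → x ∈ p ─ q → x ∉ q
x∈p─q⇒x∉q (_ ∷ p) (_ ∷ q) (there x∈) (there x∈q) = x∈p─q⇒x∉q p q x∈ x∈q

module _ {n : ℕ} where

  ∪-lub : ∀ {p q r : Subset n} → p ⊆ r → q ⊆ r → p ∪ q ⊆ r
  ∪-lub {p} {q} p⊆r q⊆r x∈ with x∈p∪q⁻ p q x∈
  ... | inj₁ x∈p = p⊆r x∈p
  ... | inj₂ x∈q = q⊆r x∈q

  ∈-⋃⁻ : ∀ (Xs : List (Subset n)) {x} → x ∈ ⋃ Xs → Any (x ∈_) Xs
  ∈-⋃⁻ []       x∈ = contradiction x∈ ∉⊥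
  ∈-⋃⁻ (X ∷ Xs) x∈ with x∈p∪q⁻ X (⋃ Xs) x∈
  ... | inj₁ x∈X  = here x∈X
  ... | inj₂ x∈Xs = there (∈-⋃⁻ Xs x∈Xs)

  ⊆-⋃ : ∀ {X : Subset n} {Xs} → X ∈ₗ Xs → X ⊆ ⋃ Xs
  ⊆-⋃ {Xs = _ ∷ Xs} (here refl) = p⊆p∪q (⋃ Xs)
  ⊆-⋃ {Xs = Y ∷ Xs} (there X∈) x∈ = q⊆p∪q Y (⋃ Xs) (⊆-⋃ X∈ x∈)

  ∈-⋂⁺ : ∀ {x} {Xs : List (Subset n)} → All (x ∈_) Xs → x ∈ ⋂ Xs
  ∈-⋂⁺ []           = ∈⊤
  ∈-⋂⁺ (x∈X ∷ x∈Xs) = x∈p∩q⁺ (x∈X , ∈-⋂⁺ x∈Xs)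

  ∈-⋂⁻ : ∀ {x} (Xs : List (Subset n)) → x ∈ ⋂ Xs → All (x ∈_) Xs
  ∈-⋂⁻ []       _  = []
  ∈-⋂⁻ (X ∷ Xs) x∈ = let x∈X , x∈⋂Xs = x∈p∩q⁻ X (⋂ Xs) x∈ in x∈X ∷ ∈-⋂⁻ Xs x∈⋂Xs

module _ {n : ℕ} where

  Adjacent : List (Subset n) → Subset n → Subset n → Set
  Adjacent xs P Q = P ∈ₗ xs × Q ∈ₗ xs × (∀ {W} → W ∈ₗ xs → W ⊆ P ⊎ Q ⊆ W)

  adjacent-∷ : ∀ {A xs P Q} → All (A ⊆_) xs → Adjacent xs P Q → Adjacent (A ∷ xs) P Q
  adjacent-∷ A⊆xs (P∈ , Q∈ , between) =
    there P∈ , there Q∈ , λ { (here refl) → inj₁ (All.lookup A⊆xs P∈) ; (there W∈) → between W∈ }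

  separatingPair : ∀ {x A xs} → AllPairs _⊆_ (A ∷ xs) → x ∉ A → Any (x ∈_) xs →
                   ∃₂ λ P Q → Adjacent (A ∷ xs) P Q × x ∈ Q ─ P
  separatingPair {x} {A} {B ∷ xs} ((A⊆B ∷ A⊆xs) ∷ B⊆xs ∷ chain) x∉A x∈xs with x ∈? B
  ... | yes x∈B = A , B , adjacent , x∈p∧x∉q⇒x∈p─q x∈B x∉A
    where
    adjacent : Adjacent (A ∷ B ∷ xs) A B
    adjacent = here refl , there (here refl) ,
      λ { (here refl) → inj₁ ⊆-refl ; (there (here refl)) → inj₂ ⊆-refl
        ; (there (there W∈)) → inj₂ (All.lookup B⊆xs W∈) }
  ... | no x∉B with x∈xs
  ...   | here x∈B  = contradiction x∈B x∉B
  ...   | there x∈xs′ with separatingPair (B⊆xs ∷ chain) x∉B x∈xs′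
  ...     | P , Q , adjacent , x∈Q─P = P , Q , adjacent-∷ (A⊆B ∷ A⊆xs) adjacent , x∈Q─P

  separatingPair-⊥⊤ : ∀ {xs} → AllPairs _⊆_ xs → ⊥ ∈ₗ xs → ⊤ ∈ₗ xs → ∀ x →
                      ∃₂ λ P Q → Adjacent xs P Q × x ∈ Q ─ P
  separatingPair-⊥⊤ {xs} chain ⊥∈ ⊤∈ x
    with separatingPair (All.tabulate (λ _ → ⊥⊆) ∷ chain) ∉⊥ (lose ⊤∈ ∈⊤)
  ... | P , Q , (P∈ , Q∈ , between) , x∈Q─P =
    P , Q , (drop⊥ P∈ , drop⊥ Q∈ , λ W∈ → between (there W∈)) , x∈Q─P
    where
    drop⊥ : ∀ {W} → W ∈ₗ ⊥ ∷ xs → W ∈ₗ xs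
    drop⊥ (here refl) = ⊥∈
    drop⊥ (there W∈)  = W∈

  blocks-∈ : ∀ (xs : List (Subset n)) {b} → b ∈ₗ chainBlocks xs →
             ∃₂ λ P Q → P ∈ₗ xs × Q ∈ₗ xs × b ≡ Q ─ P
  blocks-∈ (A ∷ B ∷ xs) (here refl) = A , B , here refl , there (here refl) , refl
  blocks-∈ (A ∷ B ∷ xs) (there b∈) with blocks-∈ (B ∷ xs) b∈
  ... | P , Q , P∈ , Q∈ , b≡ = P , Q , there P∈ , there Q∈ , b≡

  adjacent-block-⊆ : ∀ {xs P Q P′ Q′ y} → Adjacent xs P Q → P′ ∈ₗ xs → Q′ ∈ₗ xs →
                     y ∈ Q ─ P → y ∈ Q′ ─ P′ → Q ─ P ⊆ Q′ ─ P′
  adjacent-block-⊆ {P = P} {Q} {P′} {Q′} (_ , _ , between) P′∈ Q′∈ y∈Q─P y∈Q′─P′ x∈Q─P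
    with between P′∈ | between Q′∈
  ... | inj₂ Q⊆P′ | _ = contradiction (Q⊆P′ (p─q⊆p Q P y∈Q─P)) (x∈p─q⇒x∉q Q′ P′ y∈Q′─P′)
  ... | _ | inj₁ Q′⊆P = contradiction (Q′⊆P (p─q⊆p Q′ P′ y∈Q′─P′)) (x∈p─q⇒x∉q Q P y∈Q─P)
  ... | inj₁ P′⊆P | inj₂ Q⊆Q′ =
    x∈p∧x∉q⇒x∈p─q (Q⊆Q′ (p─q⊆p Q P x∈Q─P)) (λ x∈P′ → x∈p─q⇒x∉q Q P x∈Q─P (P′⊆P x∈P′))

  UnionOfBlocks : List (Subset n) → Subset n → Set
  UnionOfBlocks c U = ∀ {y} → y ∈ U → Σ (Subset n) λ b → b ∈ₗ chainBlocks c × y ∈ b × b ⊆ U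

  unionOfBlocks-block : ∀ {c b} → b ∈ₗ chainBlocks c → UnionOfBlocks c b
  unionOfBlocks-block {b = b} b∈ y∈b = b , b∈ , y∈b , ⊆-refl

  unionOfBlocks-⋃ : ∀ {c} (Us : List (Subset n)) → All (UnionOfBlocks c) Us →
                    UnionOfBlocks c (⋃ Us)
  unionOfBlocks-⋃ Us Us-blocks y∈ with find (∈-⋃⁻ Us y∈)
  ... | U , U∈ , y∈U with All.lookup Us-blocks U∈ y∈U
  ...   | b , b∈ , y∈b , b⊆U = b , b∈ , y∈b , λ z∈b → ⊆-⋃ U∈ (b⊆U z∈b)

  unionOfBlocks-∩ : ∀ {c P Q U x} → Adjacent c P Q → UnionOfBlocks c U →
                    x ∈ Q ─ P → x ∉ U → Q ∩ U ⊆ P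
  unionOfBlocks-∩ {c} {P} {Q} {U} adjacent U-blocks x∈Q─P x∉U {y} y∈Q∩U with y ∈? P
  ... | yes y∈P = y∈P
  ... | no y∉P with U-blocks (proj₂ (x∈p∩q⁻ Q U y∈Q∩U))
  ...   | b , b∈ , y∈b , b⊆U with blocks-∈ c b∈
  ...     | P′ , Q′ , P′∈ , Q′∈ , refl =
    contradiction (b⊆U (adjacent-block-⊆ adjacent P′∈ Q′∈ y∈Q─P y∈b x∈Q─P)) x∉U
    where
    y∈Q─P : y ∈ Q ─ P
    y∈Q─P = x∈p∧x∉q⇒x∈p─q (proj₁ (x∈p∩q⁻ Q U y∈Q∩U)) y∉P

module _ {n : ℕ} (C : ClosureOperator n) where
  open ClosureOperator C

  cl-least : ∀ {X Y} → Closed C Y → X ⊆ Y → cl X ⊆ Y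
  cl-least {X} {Y} closedY X⊆Y x∈ = subst (_ ∈_) closedY (monotone X Y X⊆Y x∈)

  ⋁ : List (Subset n) → Subset n
  ⋁ []       = ⊥
  ⋁ (X ∷ Xs) = cl (X ∪ ⋁ Xs)

  ⋃⊆⋁ : ∀ Xs → ⋃ Xs ⊆ ⋁ Xs
  ⋃⊆⋁ []       = ⊆-refl
  ⋃⊆⋁ (X ∷ Xs) = ⊆-trans (∪-lub (p⊆p∪q (⋁ Xs)) (⊆-trans (⋃⊆⋁ Xs) (q⊆p∪q X (⋁ Xs)))) (extensive _)

  ⋁-closed : Loopless C → ∀ Xs → Closed C (⋁ Xs)
  ⋁-closed loopless []       = loopless
  ⋁-closed _        (X ∷ Xs) = idempotent _

  module _ {S : List (Subset n)} where

    ⋂-sublattice : ⊤ ∈ₗ S → ∀ {Xs} → All (InSublattice C S) Xs → InSublattice C S (⋂ Xs)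
    ⋂-sublattice ⊤∈ []          = base ⊤∈
    ⋂-sublattice ⊤∈ (inX ∷ inXs) = meet inX (⋂-sublattice ⊤∈ inXs)

    ⋁-sublattice : ⊥ ∈ₗ S → ∀ {Xs} → All (InSublattice C S) Xs → InSublattice C S (⋁ Xs)
    ⋁-sublattice ⊥∈ []          = base ⊥∈
    ⋁-sublattice ⊥∈ (inX ∷ inXs) = join inX (⋁-sublattice ⊥∈ inXs)

    -- Q ∩ ⋁ Xs = ⋁ (Q ∩ X) by distributivity, and a closed P containing each Q ∩ X contains that join.
    ∩-⋁-⊆ : DistributiveSublattice C S → ⊥ ∈ₗ S → ∀ {P Q} → InSublattice C S Q → Closed C P →
            ∀ {Xs} → All (InSublattice C S) Xs → All (λ X → Q ∩ X ⊆ P) Xs → Q ∩ ⋁ Xs ⊆ P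
    ∩-⋁-⊆ _ _ {Q = Q} _ _ [] [] = ⊆-trans (p∩q⊆q Q ⊥) ⊥⊆
    ∩-⋁-⊆ distributive ⊥∈ {P} {Q} inQ closedP {X ∷ Xs} (inX ∷ inXs) (Q∩X⊆P ∷ Q∩Xs⊆P) x∈ =
      cl-least closedP (∪-lub Q∩X⊆P (∩-⋁-⊆ distributive ⊥∈ inQ closedP inXs Q∩Xs⊆P))
        (subst (_ ∈_) (distributive Q X (⋁ Xs) inQ inX (⋁-sublattice ⊥∈ inXs)) x∈)

  module _ {c : List (Subset n)} (maximal : IsMaximalChain C c) where

    maximalChain-⊤ : ⊤ ∈ₗ c
    maximalChain-⊤ = proj₂ maximal ⊤ (⊆-antisym ⊆⊤ (extensive ⊤)) (All.tabulate (λ _ → inj₂ ⊆⊤))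

    maximalChain-⊥ : Loopless C → ⊥ ∈ₗ c
    maximalChain-⊥ loopless = proj₂ maximal ⊥ loopless (All.tabulate (λ _ → inj₁ ⊥⊆))

    maximalChain-⊆ : AllPairs _⊆_ c
    maximalChain-⊆ = Linked⇒AllPairs ⊆-trans (Linked.map proj₁ (proj₂ (proj₁ maximal)))

    lowerSet∧unionOfBlocks⇒closed : Loopless C → ∀ {m} → DistributiveSublattice C (c ++ m) →
                                     ∀ {U} → IsLowerSet (pr c m) U → UnionOfBlocks c U → Closed C U
    lowerSet∧unionOfBlocks⇒closed loopless {m} distributive {U} lower U-blocks =
      ⊆-antisym clU⊆U (extensive U)
      where
      L : List (Subset n)
      L = c ++ m

      ⊥∈L : ⊥ ∈ₗ L
      ⊥∈L = ∈-++⁺ˡ (maximalChain-⊥ loopless)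

      ↓ : Fin n → Subset n
      ↓ s = ⋂ (filter (s ∈?_) L)

      ↓-sublattice : ∀ s → InSublattice C L (↓ s)
      ↓-sublattice s = ⋂-sublattice (∈-++⁺ˡ maximalChain-⊤) (filter⁺ (s ∈?_) (All.tabulate base))

      s∈↓s : ∀ s → s ∈ ↓ s
      s∈↓s s = ∈-⋂⁺ (all-filter (s ∈?_) L)

      ↓⊆U : ∀ {s} → s ∈ U → ↓ s ⊆ U
      ↓⊆U {s} s∈U {a} a∈ =
        lower a s s∈U λ S S∈ s∈S → All.lookup (∈-⋂⁻ _ a∈) (∈-filter⁺ (s ∈?_) S∈ s∈S)

      Us : List (Fin n)
      Us = filter (_∈? U) (allFin n)

      Xs : List (Subset n)
      Xs = map ↓ Us

      clU⊆⋁Xs : cl U ⊆ ⋁ Xs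
      clU⊆⋁Xs = cl-least (⋁-closed loopless Xs) (⊆-trans U⊆⋃Xs (⋃⊆⋁ Xs))
        where
        U⊆⋃Xs : U ⊆ ⋃ Xs
        U⊆⋃Xs {s} s∈U = ⊆-⋃ (∈-map⁺ ↓ (∈-filter⁺ (_∈? U) (∈-allFin s) s∈U)) (s∈↓s s)

      clU⊆U : cl U ⊆ U
      clU⊆U {x} x∈clU with x ∈? U
      ... | yes x∈U = x∈U
      ... | no x∉U
        with separatingPair-⊥⊤ maximalChain-⊆ (maximalChain-⊥ loopless) maximalChain-⊤ x
      ...   | P , Q , adjacent@(P∈ , Q∈ , _) , x∈Q─P =
        contradiction (Q∩⋁Xs⊆P (x∈p∩q⁺ (p─q⊆p Q P x∈Q─P , clU⊆⋁Xs x∈clU))) (x∈p─q⇒x∉q Q P x∈Q─P)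
        where
        Q∩↓s⊆P : ∀ {s} → s ∈ U → Q ∩ ↓ s ⊆ P
        Q∩↓s⊆P s∈U y∈ =
          let y∈Q , y∈↓s = x∈p∩q⁻ Q _ y∈
          in unionOfBlocks-∩ adjacent U-blocks x∈Q─P x∉U (x∈p∩q⁺ (y∈Q , ↓⊆U s∈U y∈↓s))

        Q∩⋁Xs⊆P : Q ∩ ⋁ Xs ⊆ P
        Q∩⋁Xs⊆P =
          ∩-⋁-⊆ distributive ⊥∈L (base (∈-++⁺ˡ Q∈)) (All.lookup (proj₁ (proj₁ maximal)) P∈)
            (map⁺ (All.universal ↓-sublattice Us))
            (map⁺ (All.map Q∩↓s⊆P (all-filter (_∈? U) (allFin n))))

mainTheorem18 : (n : ℕ) (C : ClosureOperator n) → Loopless C → Supersolvable C →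
    (c : List (Subset n)) → IsChiefChain C c →
    (m : List (Subset n)) → IsMaximalChain C m →
    (F : List (Subset n)) → Vpr (pr c m) F → InSupp c F → Vcl C F
mainTheorem18 n C loopless _ c (maximal , chief) m (chain , _) F (composition , lower) (_ , inSupp) =
  composition , All.zipWith {Q = UnionOfBlocks c} (uncurry closed) (lower , blocks)
  where
  closed : ∀ {U} → IsLowerSet (pr c m) U → UnionOfBlocks c U → Closed C U
  closed = lowerSet∧unionOfBlocks⇒closed C maximal loopless (chief m chain)

  blockUnion : ∀ {B} → (Σ (List (Subset n)) λ sel → All (_∈ₗ chainBlocks c) sel × B ≡ ⋃ sel) →
               UnionOfBlocks c B
  blockUnion (sel , sel⊆blocks , refl) = unionOfBlocks-⋃ sel (All.map unionOfBlocks-block sel⊆blocks)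

  blocks : All (UnionOfBlocks c) (initialUnions F)
  blocks = map⁺ (All.map (unionOfBlocks-⋃ _) (inits⁺ (All.map blockUnion inSupp)))
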